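{- Let $\mathcal{T}$ be a test cover of $[n]$ containing every singleton $\{i\}$, $i\in[n]$, let $k$ be a positive integer, and let $\mathcal{F}$ be the output of Greedy-mini-test on $\mathcal{T}$ and $k$, where $|\mathcal{F}|<2k-2$. Let $C_1,\ldots,C_l$ be the classes induced by $\mathcal{F}$, and assume that for every $i$ and every $C_i$-test $S\in\mathcal{T}$ we have $|S\cap C_i|\le|C_i|/2$. Then for every $i$, every non-leaf vertex of the out-tree $O_i$ has out-degree at least two.
   Context: $[n]=\{1,\ldots,n\}$ is the set of items; tests are subsets of $[n]$ and $\mathcal{T}$ is a collection of distinct tests. A test $T$ separates distinct items $i,j$ if $|\{i,j\}\cap T|=1$; a collection of tests is a test cover of $[n]$ if every pair of distinct items is separated by one of its tests. The classes induced by a collection $\mathcal{F}$ of tests are the equivalence classes of the relation "$i,j$ are not separated by any test of $\mathcal{F}$". For $C\subseteq[n]$, a test $S\in\mathcal{T}$ is a $C$-test if $C\setminus S\neq\emptyset$ and $C\cap S\neq\emptyset$; for a $C_i$-test $S$, $L(S)=C_i\cap S$. Algorithm Greedy-mini-test($\mathcal{T}$, $k$): start with $\mathcal{F}=\emptyset$; repeatedly, as long as $|\mathcal{F}|<2k-2$ and one of the following moves is possible, perform one: (a) add two tests of $\mathcal{T}\setminus\mathcal{F}$ to $\mathcal{F}$ if this increases the number of classes induced by $\mathcal{F}$ by at least $3$; (b) add one test of $\mathcal{T}\setminus\mathcal{F}$ if this increases the number of classes induced by $\mathcal{F}$ by at least $2$. Stop when $|\mathcal{F}|\ge 2k-2$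 or no move is possible; output $\mathcal{F}$. The digraph $O_i$: its vertices are a root $r$ with $S_r=C_i$, together with one vertex $v$ for each distinct set $S_v\subseteq C_i$ such that $S_v=L(S)$ for some $C_i$-test $S\in\mathcal{T}$; there is an arc from $v$ to $w$ if $S_w\subsetneq S_v$ and there is no vertex $u$ with $S_w\subsetneq S_u\subsetneq S_v$. (Under the hypotheses, $O_i$ is an out-tree, i.e. an orientation of a tree with a unique vertex of in-degree zero, the root; a leaf is a vertex of out-degree zero.) -}

module Defs where

open import Data.Nat using (ℕ; zero; suc; _+_; _*_; _∸_; _≤_; _<_)
open import Data.Bool using (Bool; true; false; not; _xor_)
open import Data.Fin using (Fin)
open import Data.Fin.Subset using (Subset; _∩_; _─_; _⊂_; Nonempty)
open import Data.Vec using (lookup; tabulate)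
open import Data.List using (List; []; _∷_; length; map; allFin; deduplicate)
open import Data.Bool.ListAction using (any)
open import Data.Vec.Properties using (≡-dec)
import Data.Bool as B
open import Data.List.Membership.Propositional using () renaming (_∈_ to _∈ₗ_; _∉_ to _∉ₗ_)
open import Data.Product using (Σ; ∃; _×_; _,_)
open import Data.Sum using (_⊎_)
open import Relation.Binary.PropositionalEquality using (_≡_; _≢_)
open import Relation.Nullary using (¬_)

Test : ℕ → Set
Test n = Subset n

Tests : ℕ → Set
Tests n = List (Test n)

separatesᵇ : ∀ {n} → Test n → Fin n → Fin n → Bool
separatesᵇ T i j = lookup T i xor lookup T j

separatedByᵇ : ∀ {n} → Tests n → Fin n → Fin n → Bool
separatedByᵇ 𝓕 i j = any (λ T → separatesᵇ T i j) 𝓕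

IsTestCover : ∀ {n} → Tests n → Set
IsTestCover {n} 𝓣 = (i j : Fin n) → i ≢ j → separatedByᵇ 𝓣 i j ≡ true

classOf : ∀ {n} → Tests n → Fin n → Subset n
classOf 𝓕 i = tabulate (λ j → not (separatedByᵇ 𝓕 i j))

numClasses : ∀ {n} → Tests n → ℕ
numClasses {n} 𝓕 = length (deduplicate (≡-dec B._≟_) (map (classOf 𝓕) (allFin n)))

data Move {n} (𝓣 : Tests n) (k : ℕ) (𝓕 : Tests n) : Tests n → Set where
  moveA : (T₁ T₂ : Test n) → length 𝓕 < 2 * k ∸ 2 →
          T₁ ∈ₗ 𝓣 → T₁ ∉ₗ 𝓕 → T₂ ∈ₗ 𝓣 → T₂ ∉ₗ 𝓕 → T₁ ≢ T₂ →
          3 + numClasses 𝓕 ≤ numClasses (T₁ ∷ T₂ ∷ 𝓕) →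
          Move 𝓣 k 𝓕 (T₁ ∷ T₂ ∷ 𝓕)
  moveB : (T₁ : Test n) → length 𝓕 < 2 * k ∸ 2 →
          T₁ ∈ₗ 𝓣 → T₁ ∉ₗ 𝓕 →
          2 + numClasses 𝓕 ≤ numClasses (T₁ ∷ 𝓕) →
          Move 𝓣 k 𝓕 (T₁ ∷ 𝓕)

data Reachable {n} (𝓣 : Tests n) (k : ℕ) : Tests n → Set where
  start : Reachable 𝓣 k []
  step  : ∀ {𝓕 𝓕′} → Reachable 𝓣 k 𝓕 → Move 𝓣 k 𝓕 𝓕′ → Reachable 𝓣 k 𝓕′

IsGreedyOutput : ∀ {n} → Tests n → ℕ → Tests n → Set
IsGreedyOutput {n} 𝓣 k 𝓕 =
  Reachable 𝓣 k 𝓕 × (2 * k ∸ 2 ≤ length 𝓕 ⊎ (∀ 𝓕′ → ¬ Move 𝓣 k 𝓕 𝓕′))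

-- S is a C-test (S ∈ 𝓣 is required separately)
IsCTest : ∀ {n} → Subset n → Test n → Set
IsCTest C S = Nonempty (C ─ S) × Nonempty (C ∩ S)

IsVertex : ∀ {n} → Tests n → Subset n → Subset n → Set
IsVertex 𝓣 C V = V ≡ C ⊎ ∃ (λ S → S ∈ₗ 𝓣 × IsCTest C S × V ≡ C ∩ S)

-- arc V → W of O_C (vertices are identified with their sets)
IsArc : ∀ {n} → Tests n → Subset n → Subset n → Subset n → Set
IsArc 𝓣 C V W =
  IsVertex 𝓣 C V × IsVertex 𝓣 C W × W ⊂ V ×
  ¬ ∃ (λ U → IsVertex 𝓣 C U × W ⊂ U × U ⊂ V)

module Submission where

-- Only the singleton tests matter.  If V has a child W, pick j ∈ V ∖ W and
-- w ∈ W.  The singleton {j} is a C-test (it splits j from w), so {j} is a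
-- vertex strictly below V.  Climbing from {j} through vertices strictly
-- below V (finitely often, since the size grows) reaches a child of V
-- containing j, which therefore differs from W.

open import Defs
open import Data.Nat using (ℕ; zero; suc; _+_; _*_; _∸_; _≤_; _<_; NonZero)
open import Data.Nat.Properties using (≤-trans; +-monoʳ-≤; m≤m+n; <⇒≱; +-suc)
open import Data.Fin using (Fin)
open import Data.Fin.Subset using (Subset; ⁅_⁆; ∣_∣; _∩_; _─_; _⊆_; _⊂_; _∈_; Nonempty)
open import Data.Fin.Subset.Properties
  using (p∩q⊆p; nonempty?; _⊂?_; ⊂-irref; ⊂-⊆-trans; p⊂q⇒∣p∣<∣q∣;
         x∈p∩q⁺; x∈p∩q⁻; x∈⁅x⁆; x∈⁅y⁆⇒x≡y; x≢y⇒x∉⁅y⁆; x∈p∧x∉q⇒x∈p─q)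
open import Data.List using (length)
open import Data.List.Membership.Propositional using (find; lose) renaming (_∈_ to _∈ₗ_)
open import Data.List.Relation.Unary.Any using (Any; any?)
open import Data.List.Relation.Unary.Unique.Propositional using (Unique)
open import Data.Product using (∃; _×_; _,_; proj₁; proj₂)
open import Data.Sum using (inj₁; inj₂)
open import Relation.Nullary using (Dec; yes; no; contradiction)
open import Relation.Nullary.Decidable using (_×-dec_)
open import Relation.Binary.PropositionalEquality using (_≡_; refl; _≢_; subst; sym)

module OutTree {n : ℕ} (𝓣 : Tests n) (C : Subset n) where

  IsVertex⇒⊆ : ∀ {V} → IsVertex 𝓣 C V → V ⊆ C
  IsVertex⇒⊆ (inj₁ refl)                = λ x∈C → x∈C
  IsVertex⇒⊆ (inj₂ (S , _ , _ , refl)) = p∩q⊆p C S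

  ⊂-vertex-nonempty : ∀ {V W} → IsVertex 𝓣 C V → IsVertex 𝓣 C W → W ⊂ V → Nonempty W
  ⊂-vertex-nonempty vV (inj₁ refl) C⊂V = contradiction (⊂-⊆-trans C⊂V (IsVertex⇒⊆ vV)) (⊂-irref refl)
  ⊂-vertex-nonempty _ (inj₂ (_ , _ , (_ , C∩S≢∅) , refl)) _ = C∩S≢∅

  LiesBetween : Subset n → Subset n → Test n → Set
  LiesBetween U V S = IsCTest C S × U ⊂ C ∩ S × C ∩ S ⊂ V

  liesBetween? : ∀ U V S → Dec (LiesBetween U V S)
  liesBetween? U V S =
    (nonempty? (C ─ S) ×-dec nonempty? (C ∩ S)) ×-dec ((U ⊂? C ∩ S) ×-dec (C ∩ S ⊂? V))

  vertex-between⇒test-between : ∀ {U V} → IsVertex 𝓣 C V →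
    ∃ (λ U′ → IsVertex 𝓣 C U′ × U ⊂ U′ × U′ ⊂ V) → Any (LiesBetween U V) 𝓣
  vertex-between⇒test-between vV (_ , inj₁ refl , _ , C⊂V) =
    contradiction (⊂-⊆-trans C⊂V (IsVertex⇒⊆ vV)) (⊂-irref refl)
  vertex-between⇒test-between _ (_ , inj₂ (S , S∈𝓣 , S-test , refl) , U⊂ , ⊂V) =
    lose S∈𝓣 (S-test , U⊂ , ⊂V)

  -- Recursion on the fuel m, which bounds ∣ V ∣ ∸ ∣ U ∣.
  ⊂-vertex⇒below-child : ∀ {V} → IsVertex 𝓣 C V →
    (m : ℕ) (U : Subset n) → IsVertex 𝓣 C U → U ⊂ V → ∣ V ∣ ≤ m + ∣ U ∣ →
    ∃ λ W → U ⊆ W × IsArc 𝓣 C V W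
  ⊂-vertex⇒below-child {V} vV m U vU U⊂V ∣V∣≤m+∣U∣ with any? (liesBetween? U V) 𝓣
  ... | no ¬between =
    U , (λ x∈U → x∈U) , vV , vU , U⊂V , λ mid → ¬between (vertex-between⇒test-between vV mid)
  ... | yes between with find between | m
  ...   | _                             | zero = contradiction ∣V∣≤m+∣U∣ (<⇒≱ (p⊂q⇒∣p∣<∣q∣ U⊂V))
  ...   | S , S∈𝓣 , S-test , U⊂U′ , U′⊂V | suc m′
    with ⊂-vertex⇒below-child vV m′ (C ∩ S) (inj₂ (S , S∈𝓣 , S-test , refl)) U′⊂V ∣V∣≤m′+∣U′∣
    where
    ∣V∣≤m′+∣U′∣ : ∣ V ∣ ≤ m′ + ∣ C ∩ S ∣
    ∣V∣≤m′+∣U′∣ = ≤-trans ∣V∣≤m+∣U∣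
      (subst (_≤ m′ + ∣ C ∩ S ∣) (+-suc m′ ∣ U ∣) (+-monoʳ-≤ m′ (p⊂q⇒∣p∣<∣q∣ U⊂U′)))
  ...     | W , U′⊆W , arc = W , (λ x∈U → U′⊆W (proj₁ U⊂U′ x∈U)) , arc

  singleton-vertex : ∀ {i j} → ⁅ j ⁆ ∈ₗ 𝓣 → i ∈ C → j ∈ C → i ≢ j → IsVertex 𝓣 C (C ∩ ⁅ j ⁆)
  singleton-vertex {i} {j} ⁅j⁆∈𝓣 i∈C j∈C i≢j =
    inj₂ (⁅ j ⁆ , ⁅j⁆∈𝓣 ,
          ((i , x∈p∧x∉q⇒x∈p─q i∈C (x≢y⇒x∉⁅y⁆ i≢j)) , (j , x∈p∩q⁺ (j∈C , x∈⁅x⁆ j))) , refl)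

  ∈-∩⁅⁆⇒≡ : ∀ {i j} → i ∈ C ∩ ⁅ j ⁆ → i ≡ j
  ∈-∩⁅⁆⇒≡ {j = j} i∈ = x∈⁅y⁆⇒x≡y j (proj₂ (x∈p∩q⁻ C ⁅ j ⁆ i∈))

  child⇒two-children : (∀ i → ⁅ i ⁆ ∈ₗ 𝓣) → ∀ {V W} → IsArc 𝓣 C V W →
    ∃ (λ W₁ → ∃ (λ W₂ → IsArc 𝓣 C V W₁ × IsArc 𝓣 C V W₂ × W₁ ≢ W₂))
  child⇒two-children singletons {V} {W} arc@(vV , vW , W⊂V@(W⊆V , j , j∈V , j∉W) , _)
    with ⊂-vertex-nonempty vV vW W⊂V
  ... | i , i∈W with ⊂-vertex⇒below-child vV ∣ V ∣ (C ∩ ⁅ j ⁆) vU U⊂V (m≤m+n ∣ V ∣ _)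
    where
    V⊆C = IsVertex⇒⊆ vV
    i≢j : i ≢ j
    i≢j refl = j∉W i∈W
    vU : IsVertex 𝓣 C (C ∩ ⁅ j ⁆)
    vU = singleton-vertex (singletons j) (V⊆C (W⊆V i∈W)) (V⊆C j∈V) i≢j
    U⊂V : C ∩ ⁅ j ⁆ ⊂ V
    U⊂V = (λ x∈U → subst (_∈ V) (sym (∈-∩⁅⁆⇒≡ x∈U)) j∈V)
        , i , W⊆V i∈W , λ i∈U → i≢j (∈-∩⁅⁆⇒≡ i∈U)
  ...   | W′ , U⊆W′ , arc′ =
    W , W′ , arc , arc′ , λ { refl → j∉W (U⊆W′ (x∈p∩q⁺ (IsVertex⇒⊆ vV j∈V , x∈⁅x⁆ j))) }

lemma6 : (n : ℕ) (𝓣 : Tests n) (k : ℕ) (𝓕 : Tests n) →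
         Unique 𝓣 → IsTestCover 𝓣 → (∀ (i : Fin n) → ⁅ i ⁆ ∈ₗ 𝓣) →
         NonZero k →
         IsGreedyOutput 𝓣 k 𝓕 → length 𝓕 < 2 * k ∸ 2 →
         (∀ (x : Fin n) (S : Subset n) → S ∈ₗ 𝓣 → IsCTest (classOf 𝓕 x) S →
            2 * ∣ S ∩ classOf 𝓕 x ∣ ≤ ∣ classOf 𝓕 x ∣) →
         ∀ (x : Fin n) (V : Subset n) → IsVertex 𝓣 (classOf 𝓕 x) V →
         ∃ (λ W → IsArc 𝓣 (classOf 𝓕 x) V W) →
         ∃ (λ W₁ → ∃ (λ W₂ → IsArc 𝓣 (classOf 𝓕 x) V W₁ × IsArc 𝓣 (classOf 𝓕 x) V W₂ × W₁ ≢ W₂))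
lemma6 n 𝓣 k 𝓕 _ _ singletons _ _ _ _ x V _ (_ , arc) =
  OutTree.child⇒two-children 𝓣 (classOf 𝓕 x) singletons arc
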